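{- Let $E: y^2=x^3+ax^2+bx+c$ ($a,b,c\in\mathbb{Z}$) be an elliptic curve, $P\in E(\mathbb{Q})$ a point of infinite order, $k\ge1$, and $p$ an odd prime with $p\mid\tau_k$. Then $2^{k-1}P$ reduces modulo $p$ to a singular point of the reduced curve, and $n_{k-1}\equiv 0\pmod p$ (i.e. the numerator of $Y(2^{k-1}P)$ is divisible by $p$).
   Context: An elliptic curve is a non-singular cubic $y^2=x^3+ax^2+bx+c$ with $a,b,c\in\mathbb{Z}$, projectively $y^2z=x^3+ax^2z+bxz^2+cz^3$. For $k\ge0$ write $2^kP=\left(\frac{m_k}{e_k^2},\frac{n_k}{e_k^3}\right)$ with $m_k,n_k,e_k\in\mathbb{Z}$, $e_k\ge1$, $\gcd(m_k,e_k)=\gcd(n_k,e_k)=1$. Define $F_0(E,P)=e_0$, $F_k(E,P)=e_k/e_{k-1}$ and $\tau_k=\frac{2n_{k-1}}{F_k(E,P)}\in\mathbb{Z}$ for $k\ge1$. A point $\left(\frac{m}{e^2},\frac{n}{e^3}\right)$ reduces mod $p$ to $(me\bmod p:n\bmod p:e^3\bmod p)$ on the curve $y^2z=x^3+ax^2z+bxz^2+cz^3$ over $\mathbb{F}_p$; a singular point is one where this cubic form and all its partial derivatives vanish. -}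

module Defs where

open import Data.Nat as ℕ using (ℕ; zero; suc)
open import Data.Integer as ℤ using (ℤ; +_; +[1+_]; -[1+_])
open import Data.Integer.Divisibility using () renaming (_∣_ to _∣ℤ_)
open import Data.Rational as ℚ using (ℚ; mkℚ; 0ℚ; 1ℚ; 1/_)
open import Data.Rational.Properties using () renaming (_≟_ to _≟ℚ_)
open import Data.Nat.Coprimality using (Coprime)
open import Data.Maybe using (Maybe; just; nothing)
open import Data.Product using (_×_; _,_)
open import Relation.Binary.PropositionalEquality using (_≡_; _≢_)
open import Relation.Nullary using (yes; no; ¬_)

-- Total inverse on ℚ (inv 0 = 0); only ever applied to non-zero arguments below.
inv : ℚ → ℚ
inv q@(mkℚ (+ zero) _ _)      = 0ℚ
inv q@(mkℚ +[1+ n ] _ _)      = 1/ q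
inv q@(mkℚ -[1+ n ] _ _)      = 1/ q

ι : ℤ → ℚ
ι z = z ℚ./ 1

disc : ℤ → ℤ → ℤ → ℤ
disc a b c = a ℤ.* a ℤ.* b ℤ.* b ℤ.- + 4 ℤ.* b ℤ.* b ℤ.* b ℤ.- + 4 ℤ.* a ℤ.* a ℤ.* a ℤ.* c
             ℤ.- + 27 ℤ.* c ℤ.* c ℤ.+ + 18 ℤ.* a ℤ.* b ℤ.* c

OnCurve : ℤ → ℤ → ℤ → ℚ → ℚ → Set
OnCurve a b c x y = y ℚ.* y ≡ x ℚ.* x ℚ.* x ℚ.+ ι a ℚ.* x ℚ.* x ℚ.+ ι b ℚ.* x ℚ.+ ι c

-- Points of E(ℚ): nothing = point at infinity O, just (x , y) = affine point
Pt : Set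
Pt = Maybe (ℚ × ℚ)

addPt : ℤ → ℤ → ℤ → Pt → Pt → Pt
addPt a b c nothing Q = Q
addPt a b c (just P) nothing = just P
addPt a b c (just (x₁ , y₁)) (just (x₂ , y₂)) with x₁ ≟ℚ x₂
... | no _ = third ((y₂ ℚ.- y₁) ℚ.* inv (x₂ ℚ.- x₁))
  where
  third : ℚ → Pt
  third l = let x₃ = l ℚ.* l ℚ.- ι a ℚ.- x₁ ℚ.- x₂
            in just (x₃ , ℚ.- (y₁ ℚ.+ l ℚ.* (x₃ ℚ.- x₁)))
... | yes _ with (y₁ ℚ.+ y₂) ≟ℚ 0ℚ
...   | yes _ = nothing
...   | no _ = third ((ι (+ 3) ℚ.* x₁ ℚ.* x₁ ℚ.+ ι (+ 2) ℚ.* ι a ℚ.* x₁ ℚ.+ ι b)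
                      ℚ.* inv (ι (+ 2) ℚ.* y₁))
  where
  third : ℚ → Pt
  third l = let x₃ = l ℚ.* l ℚ.- ι a ℚ.- x₁ ℚ.- x₂
            in just (x₃ , ℚ.- (y₁ ℚ.+ l ℚ.* (x₃ ℚ.- x₁)))

mulPt : ℤ → ℤ → ℤ → ℕ → Pt → Pt
mulPt a b c zero    P = nothing
mulPt a b c (suc n) P = addPt a b c P (mulPt a b c n P)

dblPow : ℤ → ℤ → ℤ → ℕ → Pt → Pt
dblPow a b c zero    P = P
dblPow a b c (suc k) P = let Q = dblPow a b c k P in addPt a b c Q Q

InfiniteOrder : ℤ → ℤ → ℤ → Pt → Set
InfiniteOrder a b c P = ∀ (n : ℕ) → mulPt a b c (suc n) P ≢ nothing

Rep : Pt → ℤ → ℤ → ℕ → Set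
Rep Q m n e =
  (1 ℕ.≤ e) × Coprime (ℤ.∣ m ∣) e × Coprime (ℤ.∣ n ∣) e ×
  Data.Product.Σ (ℚ × ℚ) (λ { (x , y) →
      (Q ≡ just (x , y)) ×
      (x ℚ.* ι (+ (e ℕ.* e)) ≡ ι m) ×
      (y ℚ.* ι (+ (e ℕ.* e ℕ.* e)) ≡ ι n) })

cubicF : ℤ → ℤ → ℤ → ℤ → ℤ → ℤ → ℤ
cubicF a b c X Y Z = Y ℤ.* Y ℤ.* Z ℤ.- X ℤ.* X ℤ.* X ℤ.- a ℤ.* X ℤ.* X ℤ.* Z
                     ℤ.- b ℤ.* X ℤ.* Z ℤ.* Z ℤ.- c ℤ.* Z ℤ.* Z ℤ.* Z

cubicFX : ℤ → ℤ → ℤ → ℤ → ℤ → ℤ → ℤ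
cubicFX a b c X Y Z = ℤ.- (+ 3 ℤ.* X ℤ.* X) ℤ.- + 2 ℤ.* a ℤ.* X ℤ.* Z ℤ.- b ℤ.* Z ℤ.* Z

cubicFY : ℤ → ℤ → ℤ → ℤ → ℤ → ℤ → ℤ
cubicFY a b c X Y Z = + 2 ℤ.* Y ℤ.* Z

cubicFZ : ℤ → ℤ → ℤ → ℤ → ℤ → ℤ → ℤ
cubicFZ a b c X Y Z = Y ℤ.* Y ℤ.- a ℤ.* X ℤ.* X ℤ.- + 2 ℤ.* b ℤ.* X ℤ.* Z
                      ℤ.- + 3 ℤ.* c ℤ.* Z ℤ.* Z

-- The point (X mod p : Y mod p : Z mod p) is a singular point of the reduced
-- projective cubic over 𝔽_p: the form and all its partials vanish mod p
-- (and the triple is a genuine projective point, i.e. not all zero mod p).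
SingularModP : ℤ → ℤ → ℤ → ℕ → ℤ → ℤ → ℤ → Set
SingularModP a b c p X Y Z =
  ¬ ((+ p ∣ℤ X) × (+ p ∣ℤ Y) × (+ p ∣ℤ Z)) ×
  (+ p ∣ℤ cubicF a b c X Y Z) ×
  (+ p ∣ℤ cubicFX a b c X Y Z) ×
  (+ p ∣ℤ cubicFY a b c X Y Z) ×
  (+ p ∣ℤ cubicFZ a b c X Y Z)

-- Write Q = 2^(k-1) P = (m/e², n/e³) and N = e⁴ f′(m/e²) = 3m² + 2ame² + be⁴.
-- As p is odd, p | τ and 2n = F τ give p | n. Clearing denominators in the
-- duplication formula x(2Q) = λ² - a - 2x(Q), λ = f′(x)/2y, gives
-- N² = τ² m′ + 4an²e² + 8mn², so p | N as well. At (me : n : e³) the cubic form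
-- vanishes since Q lies on E, F_Y = 2nZ and F_X = -e²N vanish mod p, and Euler's
-- relation Z F_Z = 3F - X F_X - Y F_Y forces F_Z ≡ 0, because p ∤ Z = e³ when
-- gcd(n, e) = 1.

module Submission where

open import Defs
open import Level using (0ℓ)
open import Data.Empty using (⊥-elim)
open import Data.List using (_∷_; [])
open import Data.Maybe using (just)
open import Data.Nat as ℕ using (ℕ; zero; suc; _∸_; _≤_)
open import Data.Nat.Primality using (Prime)
open import Data.Integer as ℤ using (ℤ; +_; +[1+_]; -[1+_])
open import Data.Integer.Divisibility as ℤD using ()
open import Data.Integer.Divisibility.Signed
  using (_∣_; divides; ∣ᵤ⇒∣; ∣⇒∣ᵤ; ∣m∣n⇒∣m+n; ∣m⇒∣m*n; ∣n⇒∣m*n)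
import Data.Integer.Properties as ℤP
open import Data.Integer.Tactic.RingSolver using () renaming (ring to ℤ-ring)
open import Data.Rational as ℚ using (ℚ; mkℚ; 0ℚ; 1ℚ)
import Data.Rational.Properties as ℚP
open import Data.Rational.Properties using () renaming (_≟_ to _≟ℚ_)
import Data.Nat.Coprimality as Coprimality
open import Data.Product using (Σ; _×_; _,_)
open import Function using (id; _∘_; flip)
open import Relation.Nullary using (yes; no)
open import Relation.Nullary.Decidable using (dec⇒maybe)
open import Relation.Binary.PropositionalEquality
open import Tactic.RingSolver using (solve-∀; solve)
open import Tactic.RingSolver.Core.AlmostCommutativeRing
  using (AlmostCommutativeRing; fromCommutativeRing)

-- The zero test lets the solver discard rational constants that cancel.
ℚ-ring : AlmostCommutativeRing 0ℓ 0ℓ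
ℚ-ring = fromCommutativeRing ℚP.+-*-commutativeRing (λ q → dec⇒maybe (0ℚ ≟ℚ q))

ι≡mkℚ : ∀ z → ι z ≡ mkℚ z 0 (Coprimality.sym (Coprimality.1-coprimeTo ℤ.∣ z ∣))
ι≡mkℚ (+ n)    = ℚP.normalize-coprime (Coprimality.sym (Coprimality.1-coprimeTo n))
ι≡mkℚ -[1+ n ] = cong ℚ.-_ (ℚP.normalize-coprime (Coprimality.sym (Coprimality.1-coprimeTo (suc n))))

ι-injective : ∀ {i j} → ι i ≡ ι j → i ≡ j
ι-injective {i} {j} eq = begin
  i             ≡⟨ cong ℚ.↥_ (ι≡mkℚ i) ⟨
  ℚ.↥ (ι i)     ≡⟨ cong ℚ.↥_ eq ⟩
  ℚ.↥ (ι j)     ≡⟨ cong ℚ.↥_ (ι≡mkℚ j) ⟩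
  j             ∎
  where open ≡-Reasoning

ι-homo-+ : ∀ i j → ι (i ℤ.+ j) ≡ ι i ℚ.+ ι j
ι-homo-+ i j rewrite ι≡mkℚ i | ι≡mkℚ j =
  cong₂ (λ u v → (u ℤ.+ v) ℚ./ 1) (sym (ℤP.*-identityʳ i)) (sym (ℤP.*-identityʳ j))

ι-homo-* : ∀ i j → ι (i ℤ.* j) ≡ ι i ℚ.* ι j
ι-homo-* i j rewrite ι≡mkℚ i | ι≡mkℚ j = refl

ι-pos-* : ∀ u v → ι (+ (u ℕ.* v)) ≡ ι (+ u) ℚ.* ι (+ v)
ι-pos-* u v = trans (cong ι (ℤP.pos-* u v)) (ι-homo-* (+ u) (+ v))

-- Integer polynomial identities are proved in ℚ and pulled back along the
-- injective ring map ι; an Expr records the polynomial so that ι can be pushed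
-- through it.

infixl 6 _⊕_
infixl 7 _⊗_

data Expr : Set where
  ⌜_⌝     : ℤ → Expr
  _⊕_ _⊗_ : Expr → Expr → Expr

⟦_⟧ℤ : Expr → ℤ
⟦ ⌜ z ⌝ ⟧ℤ = z
⟦ s ⊕ t ⟧ℤ = ⟦ s ⟧ℤ ℤ.+ ⟦ t ⟧ℤ
⟦ s ⊗ t ⟧ℤ = ⟦ s ⟧ℤ ℤ.* ⟦ t ⟧ℤ

⟦_⟧ℚ : Expr → ℚ
⟦ ⌜ z ⌝ ⟧ℚ = ι z
⟦ s ⊕ t ⟧ℚ = ⟦ s ⟧ℚ ℚ.+ ⟦ t ⟧ℚ
⟦ s ⊗ t ⟧ℚ = ⟦ s ⟧ℚ ℚ.* ⟦ t ⟧ℚ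

ι-⟦⟧ : ∀ t → ι ⟦ t ⟧ℤ ≡ ⟦ t ⟧ℚ
ι-⟦⟧ ⌜ z ⌝   = refl
ι-⟦⟧ (s ⊕ t) = trans (ι-homo-+ ⟦ s ⟧ℤ ⟦ t ⟧ℤ) (cong₂ ℚ._+_ (ι-⟦⟧ s) (ι-⟦⟧ t))
ι-⟦⟧ (s ⊗ t) = trans (ι-homo-* ⟦ s ⟧ℤ ⟦ t ⟧ℤ) (cong₂ ℚ._*_ (ι-⟦⟧ s) (ι-⟦⟧ t))

⟦⟧ℚ-injective : ∀ s t → ⟦ s ⟧ℚ ≡ ⟦ t ⟧ℚ → ⟦ s ⟧ℤ ≡ ⟦ t ⟧ℤ
⟦⟧ℚ-injective s t eq = ι-injective (trans (ι-⟦⟧ s) (trans eq (sym (ι-⟦⟧ t))))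

module OverRationals where

  open import Data.Rational using (_+_; _*_; _-_; -_)

  inv-inverseˡ : ∀ q → q ≢ 0ℚ → inv q * q ≡ 1ℚ
  inv-inverseˡ q@(mkℚ (+ zero) _ _) q≢0 = ⊥-elim (q≢0 (ℚP.↥p≡0⇒p≡0 q refl))
  inv-inverseˡ q@(mkℚ +[1+ _ ] _ _) _   = ℚP.*-inverseˡ q
  inv-inverseˡ q@(mkℚ -[1+ _ ] _ _) _   = ℚP.*-inverseˡ q

  doubling-tangent : ∀ a b c {x y x₂ y₂} →
    addPt a b c (just (x , y)) (just (x , y)) ≡ just (x₂ , y₂) →
    Σ ℚ λ l → l * (ι (+ 2) * y) ≡ ι (+ 3) * x * x + ι (+ 2) * ι a * x + ι b
            × x₂ ≡ l * l - ι a - x - x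
            × y₂ ≡ - (y + l * (x₂ - x))
  doubling-tangent a b c {x} {y} eq with x ≟ℚ x
  ... | no x≢x = ⊥-elim (x≢x refl)
  ... | yes _ with (y + y) ≟ℚ 0ℚ | eq
  ...   | yes _   | ()
  ...   | no 2y≢0 | refl = slope * inv 2y , slope-spec , refl , refl
    where
    slope = ι (+ 3) * x * x + ι (+ 2) * ι a * x + ι b
    2y = ι (+ 2) * y
    2y≡y+y : ι (+ 2) * y ≡ y + y
    2y≡y+y = solve (y ∷ []) ℚ-ring
    slope-spec : slope * inv 2y * 2y ≡ slope
    slope-spec = begin
      slope * inv 2y * 2y    ≡⟨ ℚP.*-assoc slope (inv 2y) 2y ⟩
      slope * (inv 2y * 2y)  ≡⟨ cong (slope *_) (inv-inverseˡ 2y (λ 2y≡0 → 2y≢0 (trans (sym 2y≡y+y) 2y≡0))) ⟩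
      slope * 1ℚ             ≡⟨ ℚP.*-identityʳ slope ⟩
      slope                  ∎
      where open ≡-Reasoning

  -- Taylor expansion at x of the cubic (y + l (t - x))² - f t, taken at t = x₂.
  tangent-residual : ∀ x y l x₂ A B C →
    - (y + l * (x₂ - x)) * - (y + l * (x₂ - x))
    ≡ x₂ * x₂ * x₂ + A * x₂ * x₂ + B * x₂ + C
      + (y * y - (x * x * x + A * x * x + B * x + C))
      + (l * (ι (+ 2) * y) - (ι (+ 3) * x * x + ι (+ 2) * A * x + B)) * (x₂ - x)
      + (l * l - A - x - x - x₂) * (x₂ - x) * (x₂ - x)
  tangent-residual = solve-∀ ℚ-ring

  cancel-differences : ∀ p u v w s t → p + (u - u) + (v - v) * w + (s - s) * t * t ≡ p
  cancel-differences = solve-∀ ℚ-ring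

  tangent-point-onCurve : ∀ {x y l x₂ A B C} →
    y * y ≡ x * x * x + A * x * x + B * x + C →
    l * (ι (+ 2) * y) ≡ ι (+ 3) * x * x + ι (+ 2) * A * x + B →
    x₂ ≡ l * l - A - x - x →
    - (y + l * (x₂ - x)) * - (y + l * (x₂ - x)) ≡ x₂ * x₂ * x₂ + A * x₂ * x₂ + B * x₂ + C
  tangent-point-onCurve {x} {y} {l} {x₂} {A} {B} {C} onCurve tangent x₂≡ = begin
    - (y + l * (x₂ - x)) * - (y + l * (x₂ - x))
      ≡⟨ tangent-residual x y l x₂ A B C ⟩
    f x₂ + (y * y - f x) + (l * (ι (+ 2) * y) - f′ x) * (x₂ - x) + (l * l - A - x - x - x₂) * (x₂ - x) * (x₂ - x)
      ≡⟨ cong₂ (λ u v → f x₂ + (u - f x) + (v - f′ x) * (x₂ - x) + (l * l - A - x - x - x₂) * (x₂ - x) * (x₂ - x))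
               onCurve tangent ⟩
    f x₂ + (f x - f x) + (f′ x - f′ x) * (x₂ - x) + (l * l - A - x - x - x₂) * (x₂ - x) * (x₂ - x)
      ≡⟨ cong (λ w → f x₂ + (f x - f x) + (f′ x - f′ x) * (x₂ - x) + (w - x₂) * (x₂ - x) * (x₂ - x)) (sym x₂≡) ⟩
    f x₂ + (f x - f x) + (f′ x - f′ x) * (x₂ - x) + (x₂ - x₂) * (x₂ - x) * (x₂ - x)
      ≡⟨ cancel-differences (f x₂) (f x) (f′ x) (x₂ - x) x₂ (x₂ - x) ⟩
    f x₂ ∎
    where
    open ≡-Reasoning
    f f′ : ℚ → ℚ
    f t = t * t * t + A * t * t + B * t + C
    f′ t = ι (+ 3) * t * t + ι (+ 2) * A * t + B

  double-onCurve : ∀ a b c {x y x₂ y₂} → OnCurve a b c x y →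
    addPt a b c (just (x , y)) (just (x , y)) ≡ just (x₂ , y₂) → OnCurve a b c x₂ y₂
  double-onCurve a b c {x} {y} onCurve eq with doubling-tangent a b c {x} {y} eq
  ... | l , tangent , x₂≡ , refl =
    tangent-point-onCurve {x} {y} {l} {A = ι a} {ι b} {ι c} onCurve tangent x₂≡

  dblPow-onCurve : ∀ a b c {x y} → OnCurve a b c x y →
    ∀ k {x′ y′} → dblPow a b c k (just (x , y)) ≡ just (x′ , y′) → OnCurve a b c x′ y′
  dblPow-onCurve a b c onCurve zero    refl = onCurve
  dblPow-onCurve a b c {x} {y} onCurve (suc k) eq with dblPow a b c k (just (x , y)) in eqₖ
  ... | just (u , v) = double-onCurve a b c {u} {v} (dblPow-onCurve a b c onCurve k eqₖ) eq

  weighted-curve-identity : ∀ x y E A B C {X Y} →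
    y * y ≡ x * x * x + A * x * x + B * x + C →
    x * (E * E) ≡ X → y * (E * E * E) ≡ Y →
    Y * Y ≡ X * X * X + A * X * X * (E * E) + B * X * (E * E * E * E) + C * (E * E * E * E * E * E)
  weighted-curve-identity x y E A B C onCurve refl refl = begin
    y * (E * E * E) * (y * (E * E * E))
      ≡⟨ solve (y ∷ E ∷ []) ℚ-ring ⟩
    y * y * (E * E * E * E * E * E)
      ≡⟨ cong (_* (E * E * E * E * E * E)) onCurve ⟩
    (x * x * x + A * x * x + B * x + C) * (E * E * E * E * E * E)
      ≡⟨ solve (x ∷ E ∷ A ∷ B ∷ C ∷ []) ℚ-ring ⟩
    x * (E * E) * (x * (E * E)) * (x * (E * E)) + A * (x * (E * E)) * (x * (E * E)) * (E * E)
      + B * (x * (E * E)) * (E * E * E * E) + C * (E * E * E * E * E * E) ∎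
    where open ≡-Reasoning

  -- e⁴ f′(x) = l · 2Y · E and l² = x₂ + A + 2x.
  weighted-doubling-identity : ∀ x y l A B E F T {x₂ X Y X₂} →
    l * (ι (+ 2) * y) ≡ ι (+ 3) * x * x + ι (+ 2) * A * x + B →
    x₂ ≡ l * l - A - x - x →
    x * (E * E) ≡ X → y * (E * E * E) ≡ Y → x₂ * ((F * E) * (F * E)) ≡ X₂ →
    ι (+ 2) * Y ≡ F * T →
    (ι (+ 3) * X * X + ι (+ 2) * A * X * (E * E) + B * (E * E * E * E))
      * (ι (+ 3) * X * X + ι (+ 2) * A * X * (E * E) + B * (E * E * E * E))
    ≡ T * T * X₂ + ι (+ 4) * A * Y * Y * (E * E) + ι (+ 8) * X * Y * Y
  weighted-doubling-identity x y l A B E F T tangent refl refl refl refl 2Y≡FT = begin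
    (ι (+ 3) * (x * (E * E)) * (x * (E * E)) + ι (+ 2) * A * (x * (E * E)) * (E * E) + B * (E * E * E * E))
      * (ι (+ 3) * (x * (E * E)) * (x * (E * E)) + ι (+ 2) * A * (x * (E * E)) * (E * E) + B * (E * E * E * E))
      ≡⟨ solve (x ∷ E ∷ A ∷ B ∷ []) ℚ-ring ⟩
    (ι (+ 3) * x * x + ι (+ 2) * A * x + B) * (ι (+ 3) * x * x + ι (+ 2) * A * x + B) * (E * E * E * E * E * E * E * E)
      ≡⟨ cong (λ s → s * s * (E * E * E * E * E * E * E * E)) (sym tangent) ⟩
    l * (ι (+ 2) * y) * (l * (ι (+ 2) * y)) * (E * E * E * E * E * E * E * E)
      ≡⟨ solve (x ∷ y ∷ l ∷ A ∷ E ∷ []) ℚ-ring ⟩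
    ι (+ 2) * (y * (E * E * E)) * (ι (+ 2) * (y * (E * E * E))) * ((l * l - A - x - x) * (E * E))
      + ι (+ 4) * A * (y * (E * E * E)) * (y * (E * E * E)) * (E * E)
      + ι (+ 8) * (x * (E * E)) * (y * (E * E * E)) * (y * (E * E * E))
      ≡⟨ cong (λ s → s * s * ((l * l - A - x - x) * (E * E)) + ι (+ 4) * A * (y * (E * E * E)) * (y * (E * E * E)) * (E * E)
                     + ι (+ 8) * (x * (E * E)) * (y * (E * E * E)) * (y * (E * E * E))) 2Y≡FT ⟩
    F * T * (F * T) * ((l * l - A - x - x) * (E * E))
      + ι (+ 4) * A * (y * (E * E * E)) * (y * (E * E * E)) * (E * E)
      + ι (+ 8) * (x * (E * E)) * (y * (E * E * E)) * (y * (E * E * E))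
      ≡⟨ solve (F ∷ T ∷ l ∷ A ∷ x ∷ y ∷ E ∷ []) ℚ-ring ⟩
    T * T * ((l * l - A - x - x) * ((F * E) * (F * E)))
      + ι (+ 4) * A * (y * (E * E * E)) * (y * (E * E * E)) * (E * E)
      + ι (+ 8) * (x * (E * E)) * (y * (E * E * E)) * (y * (E * E * E)) ∎
    where open ≡-Reasoning

open OverRationals

-- e⁶ f(m/e²) and e⁴ f′(m/e²), written with E = e.
weightedCubic : ℤ → ℤ → ℤ → ℤ → ℤ → ℤ
weightedCubic a b c m E =
  m ℤ.* m ℤ.* m ℤ.+ a ℤ.* m ℤ.* m ℤ.* (E ℤ.* E) ℤ.+ b ℤ.* m ℤ.* (E ℤ.* E ℤ.* E ℤ.* E)
    ℤ.+ c ℤ.* (E ℤ.* E ℤ.* E ℤ.* E ℤ.* E ℤ.* E)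

weightedDerivative : ℤ → ℤ → ℤ → ℤ → ℤ
weightedDerivative a b m E = + 3 ℤ.* m ℤ.* m ℤ.+ + 2 ℤ.* a ℤ.* m ℤ.* (E ℤ.* E) ℤ.+ b ℤ.* (E ℤ.* E ℤ.* E ℤ.* E)

ι-pos-cube : ∀ e → ι (+ (e ℕ.* e ℕ.* e)) ≡ ι (+ e) ℚ.* ι (+ e) ℚ.* ι (+ e)
ι-pos-cube e = trans (ι-pos-* (e ℕ.* e) e) (cong (ℚ._* ι (+ e)) (ι-pos-* e e))

cleared-curve-equation : ∀ a b c x y m n e → OnCurve a b c x y →
  x ℚ.* ι (+ (e ℕ.* e)) ≡ ι m → y ℚ.* ι (+ (e ℕ.* e ℕ.* e)) ≡ ι n →
  n ℤ.* n ≡ weightedCubic a b c m (+ e)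
cleared-curve-equation a b c x y m n e onCurve x≡ y≡ =
  ⟦⟧ℚ-injective (⌜ n ⌝ ⊗ ⌜ n ⌝)
    (⌜ m ⌝ ⊗ ⌜ m ⌝ ⊗ ⌜ m ⌝ ⊕ ⌜ a ⌝ ⊗ ⌜ m ⌝ ⊗ ⌜ m ⌝ ⊗ (E ⊗ E) ⊕ ⌜ b ⌝ ⊗ ⌜ m ⌝ ⊗ (E ⊗ E ⊗ E ⊗ E)
      ⊕ ⌜ c ⌝ ⊗ (E ⊗ E ⊗ E ⊗ E ⊗ E ⊗ E))
    (weighted-curve-identity x y (ι (+ e)) (ι a) (ι b) (ι c) onCurve
      (trans (cong (x ℚ.*_) (sym (ι-pos-* e e))) x≡)
      (trans (cong (y ℚ.*_) (sym (ι-pos-cube e))) y≡))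
  where E = ⌜ + e ⌝

cleared-doubling-equation : ∀ a b c x y {x₂ y₂} m n e m₂ e₂ F τ →
  addPt a b c (just (x , y)) (just (x , y)) ≡ just (x₂ , y₂) →
  x ℚ.* ι (+ (e ℕ.* e)) ≡ ι m → y ℚ.* ι (+ (e ℕ.* e ℕ.* e)) ≡ ι n →
  x₂ ℚ.* ι (+ (e₂ ℕ.* e₂)) ≡ ι m₂ → e₂ ≡ F ℕ.* e → + 2 ℤ.* n ≡ + F ℤ.* τ →
  weightedDerivative a b m (+ e) ℤ.* weightedDerivative a b m (+ e)
    ≡ τ ℤ.* τ ℤ.* m₂ ℤ.+ + 4 ℤ.* a ℤ.* n ℤ.* n ℤ.* (+ e ℤ.* + e) ℤ.+ + 8 ℤ.* m ℤ.* n ℤ.* n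
cleared-doubling-equation a b c x y {x₂} m n e m₂ e₂ F τ 2P≡ x≡ y≡ x₂≡ refl 2n≡Fτ
  with doubling-tangent a b c {x} {y} 2P≡
... | l , tangent , x₂-def , _ =
  ⟦⟧ℚ-injective (N ⊗ N)
    (⌜ τ ⌝ ⊗ ⌜ τ ⌝ ⊗ ⌜ m₂ ⌝ ⊕ ⌜ + 4 ⌝ ⊗ ⌜ a ⌝ ⊗ ⌜ n ⌝ ⊗ ⌜ n ⌝ ⊗ (E ⊗ E) ⊕ ⌜ + 8 ⌝ ⊗ ⌜ m ⌝ ⊗ ⌜ n ⌝ ⊗ ⌜ n ⌝)
    (weighted-doubling-identity x y l (ι a) (ι b) (ι (+ e)) (ι (+ F)) (ι τ) tangent x₂-def
      (trans (cong (x ℚ.*_) (sym (ι-pos-* e e))) x≡)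
      (trans (cong (y ℚ.*_) (sym (ι-pos-cube e))) y≡)
      (trans (cong (x₂ ℚ.*_) (sym (trans (ι-pos-* (F ℕ.* e) (F ℕ.* e))
                                          (cong₂ ℚ._*_ (ι-pos-* F e) (ι-pos-* F e))))) x₂≡)
      (trans (sym (ι-homo-* (+ 2) n)) (trans (cong ι 2n≡Fτ) (ι-homo-* (+ F) τ))))
  where
  E = ⌜ + e ⌝
  N = ⌜ + 3 ⌝ ⊗ ⌜ m ⌝ ⊗ ⌜ m ⌝ ⊕ ⌜ + 2 ⌝ ⊗ ⌜ a ⌝ ⊗ ⌜ m ⌝ ⊗ (E ⊗ E) ⊕ ⌜ b ⌝ ⊗ (E ⊗ E ⊗ E ⊗ E)

module OverIntegers where

  open import Data.Integer using (_+_; _*_; _-_; -_)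
  import Data.Nat.Divisibility as ℕD
  open import Data.Nat.Primality using (euclidsLemma; prime⇒nonTrivial)
  open import Data.Nat.Coprimality using (Coprime)
  import Data.Nat.Properties as ℕP
  open import Data.Sum using (_⊎_; [_,_]′)
  import Data.Sum as Sum
  open import Relation.Nullary using (¬_; contradiction)

  cubicF-weighted : ∀ a b c m n E →
    cubicF a b c (m * E) n (E * E * E) ≡ E * E * E * (n * n - weightedCubic a b c m E)
  cubicF-weighted = expand
    where
    expand : ∀ a b c m n E →
      n * n * (E * E * E) - m * E * (m * E) * (m * E) - a * (m * E) * (m * E) * (E * E * E)
        - b * (m * E) * (E * E * E) * (E * E * E) - c * (E * E * E) * (E * E * E) * (E * E * E)
      ≡ E * E * E * (n * n - (m * m * m + a * m * m * (E * E) + b * m * (E * E * E * E)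
                               + c * (E * E * E * E * E * E)))
    expand = solve-∀ ℤ-ring

  cubicF-weighted-onCurve : ∀ a b c m n E → n * n ≡ weightedCubic a b c m E →
    cubicF a b c (m * E) n (E * E * E) ≡ + 0
  cubicF-weighted-onCurve a b c m n E curve = begin
    cubicF a b c (m * E) n (E * E * E)     ≡⟨ cubicF-weighted a b c m n E ⟩
    E * E * E * (n * n - W)                ≡⟨ cong (λ s → E * E * E * (s - W)) curve ⟩
    E * E * E * (W - W)                    ≡⟨ cong (E * E * E *_) (ℤP.+-inverseʳ W) ⟩
    E * E * E * + 0                        ≡⟨ ℤP.*-zeroʳ (E * E * E) ⟩
    + 0                                    ∎
    where
    open ≡-Reasoning
    W = weightedCubic a b c m E

  cubicFX-weighted : ∀ a b c m n E →
    cubicFX a b c (m * E) n (E * E * E) ≡ - (E * E) * weightedDerivative a b m E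
  cubicFX-weighted a b c m n E = expand a b m E
    where
    expand : ∀ a b m E →
      - (+ 3 * (m * E) * (m * E)) - + 2 * a * (m * E) * (E * E * E) - b * (E * E * E) * (E * E * E)
      ≡ - (E * E) * (+ 3 * m * m + + 2 * a * m * (E * E) + b * (E * E * E * E))
    expand = solve-∀ ℤ-ring

  cubicF-euler : ∀ a b c X Y Z →
    Z * cubicFZ a b c X Y Z ≡ + 3 * cubicF a b c X Y Z + - X * cubicFX a b c X Y Z + - Y * cubicFY a b c X Y Z
  cubicF-euler = expand
    where
    expand : ∀ a b c X Y Z →
      Z * (Y * Y - a * X * X - + 2 * b * X * Z - + 3 * c * Z * Z)
      ≡ + 3 * (Y * Y * Z - X * X * X - a * X * X * Z - b * X * Z * Z - c * Z * Z * Z)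
        + - X * (- (+ 3 * X * X) - + 2 * a * X * Z - b * Z * Z) + - Y * (+ 2 * Y * Z)
    expand = solve-∀ ℤ-ring

  module _ {p : ℕ} (p-prime : Prime p) where

    prime-∣-* : ∀ {i j} → + p ∣ i * j → + p ∣ i ⊎ + p ∣ j
    prime-∣-* {i} {j} p∣ij =
      Sum.map ∣ᵤ⇒∣ ∣ᵤ⇒∣ (euclidsLemma ℤ.∣ i ∣ ℤ.∣ j ∣ p-prime (subst (p ℕD.∣_) (ℤP.abs-* i j) (∣⇒∣ᵤ p∣ij)))

    prime-∣-square : ∀ {i} → + p ∣ i * i → + p ∣ i
    prime-∣-square p∣ii = [ id , id ]′ (prime-∣-* p∣ii)

    odd-prime-∣-2* : p ≢ 2 → ∀ {i} → + p ∣ + 2 * i → + p ∣ i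
    odd-prime-∣-2* p≢2 p∣2i = [ (λ p∣2 → contradiction (p≡2 (∣⇒∣ᵤ p∣2)) p≢2) , id ]′ (prime-∣-* {+ 2} p∣2i)
      where
      p≡2 : p ℕD.∣ 2 → p ≡ 2
      p≡2 p∣2 = ℕP.≤-antisym (ℕD.∣⇒≤ p∣2) (ℕ.nonTrivial⇒n>1 p {{prime⇒nonTrivial p-prime}})

    coprime⇒¬prime-∣ : ∀ {n e} → Coprime ℤ.∣ n ∣ e → + p ∣ n → ¬ (+ p ∣ + e)
    coprime⇒¬prime-∣ n⊥e p∣n p∣e =
      ℕ.nonTrivial⇒≢1 {{prime⇒nonTrivial p-prime}} (n⊥e (∣⇒∣ᵤ p∣n , ∣⇒∣ᵤ p∣e))

    ¬prime-∣-cube : ∀ {i} → ¬ (+ p ∣ i) → ¬ (+ p ∣ i * i * i)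
    ¬prime-∣-cube p∤i p∣i³ = [ [ p∤i , p∤i ]′ ∘ prime-∣-* , p∤i ]′ (prime-∣-* p∣i³)

    euler-∣-cubicFZ : ∀ a b c X Y Z → ¬ (+ p ∣ Z) →
      + p ∣ cubicF a b c X Y Z → + p ∣ cubicFX a b c X Y Z → + p ∣ cubicFY a b c X Y Z →
      + p ∣ cubicFZ a b c X Y Z
    euler-∣-cubicFZ a b c X Y Z p∤Z p∣F p∣FX p∣FY =
      [ flip contradiction p∤Z , id ]′ (prime-∣-* (subst (+ p ∣_) (sym (cubicF-euler a b c X Y Z))
        (∣m∣n⇒∣m+n (∣m∣n⇒∣m+n (∣n⇒∣m*n (+ 3) p∣F) (∣n⇒∣m*n (- X) p∣FX)) (∣n⇒∣m*n (- Y) p∣FY))))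

    prime-∣-weightedDerivative : ∀ a b m n e m₂ τ →
      weightedDerivative a b m e * weightedDerivative a b m e
        ≡ τ * τ * m₂ + + 4 * a * n * n * (e * e) + + 8 * m * n * n →
      + p ∣ τ → + p ∣ n → + p ∣ weightedDerivative a b m e
    prime-∣-weightedDerivative a b m n e m₂ τ N²≡ p∣τ p∣n = prime-∣-square (subst (+ p ∣_) (sym N²≡)
      (∣m∣n⇒∣m+n (∣m∣n⇒∣m+n (∣m⇒∣m*n m₂ (∣m⇒∣m*n τ p∣τ))
                            (∣m⇒∣m*n (e * e) (∣m⇒∣m*n n (∣n⇒∣m*n (+ 4 * a) p∣n))))
                 (∣m⇒∣m*n n (∣n⇒∣m*n (+ 8 * m) p∣n))))

  pos-cube : ∀ e → + (e ℕ.* e ℕ.* e) ≡ + e * + e * + e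
  pos-cube e = trans (ℤP.pos-* (e ℕ.* e) e) (cong (_* + e) (ℤP.pos-* e e))

  singular-reduction : ∀ a b c {p} m n e → Prime p → Coprime ℤ.∣ n ∣ e →
    n * n ≡ weightedCubic a b c m (+ e) → + p ∣ n → + p ∣ weightedDerivative a b m (+ e) →
    SingularModP a b c p (m * + e) n (+ (e ℕ.* e ℕ.* e))
  singular-reduction a b c {p} m n e p-prime n⊥e curve p∣n p∣N =
    subst (SingularModP a b c p (m * + e) n) (sym (pos-cube e))
      ( (λ (_ , _ , p∣Z) → p∤Z (∣ᵤ⇒∣ p∣Z))
      , ∣⇒∣ᵤ p∣F , ∣⇒∣ᵤ p∣FX , ∣⇒∣ᵤ p∣FY
      , ∣⇒∣ᵤ (euler-∣-cubicFZ p-prime a b c (m * E) n (E * E * E) p∤Z p∣F p∣FX p∣FY))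
    where
    E = + e
    p∤Z : ¬ (+ p ∣ E * E * E)
    p∤Z = ¬prime-∣-cube p-prime (coprime⇒¬prime-∣ p-prime n⊥e p∣n)
    p∣F : + p ∣ cubicF a b c (m * E) n (E * E * E)
    p∣F = subst (+ p ∣_) (sym (cubicF-weighted-onCurve a b c m n E curve)) (divides (+ 0) refl)
    p∣FX : + p ∣ cubicFX a b c (m * E) n (E * E * E)
    p∣FX = subst (+ p ∣_) (sym (cubicFX-weighted a b c m n E)) (∣n⇒∣m*n (- (E * E)) p∣N)
    p∣FY : + p ∣ cubicFY a b c (m * E) n (E * E * E)
    p∣FY = ∣m⇒∣m*n (E * E * E) (∣n⇒∣m*n (+ 2) p∣n)

open OverIntegers

open import Data.Nat using (_*_)

theorem5p5 : (a b c : ℤ) → disc a b c ≢ + 0 →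
  (x y : ℚ) → OnCurve a b c x y → InfiniteOrder a b c (just (x , y)) →
  (k : ℕ) → 1 ≤ k →
  (p : ℕ) → Prime p → p ≢ 2 →
  (m n : ℤ) (e : ℕ) → Rep (dblPow a b c (k ∸ 1) (just (x , y))) m n e →
  (m′ n′ : ℤ) (e′ : ℕ) → Rep (dblPow a b c k (just (x , y))) m′ n′ e′ →
  (F : ℕ) → e′ ≡ F * e →
  (τ : ℤ) → + 2 ℤ.* n ≡ + F ℤ.* τ → (+ p) ℤD.∣ τ →
  SingularModP a b c p (m ℤ.* + e) n (+ (e * e * e)) × (+ p) ℤD.∣ n
theorem5p5 a b c _ x y onP _ (suc k) _ p p-prime p≢2
  m n e (_ , _ , n⊥e , (xQ , yQ) , Q≡ , xQ≡ , yQ≡)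
  m₂ _ e₂ (_ , _ , _ , (x₂ , y₂) , 2Q≡ , x₂≡ , _) F e₂≡Fe τ 2n≡Fτ p∣τ =
  singular-reduction a b c m n e p-prime n⊥e curve p∣n p∣N , ∣⇒∣ᵤ p∣n
  where
  curve = cleared-curve-equation a b c xQ yQ m n e (dblPow-onCurve a b c onP k Q≡) xQ≡ yQ≡
  doubling : addPt a b c (just (xQ , yQ)) (just (xQ , yQ)) ≡ just (x₂ , y₂)
  doubling = subst (λ Q → addPt a b c Q Q ≡ just (x₂ , y₂)) Q≡ 2Q≡
  p∣n = odd-prime-∣-2* p-prime p≢2 (subst (+ p ∣_) (sym 2n≡Fτ) (∣n⇒∣m*n (+ F) (∣ᵤ⇒∣ p∣τ)))
  p∣N = prime-∣-weightedDerivative p-prime a b m n (+ e) m₂ τ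
          (cleared-doubling-equation a b c xQ yQ m n e m₂ e₂ F τ doubling xQ≡ yQ≡ x₂≡ e₂≡Fe 2n≡Fτ)
          (∣ᵤ⇒∣ p∣τ) p∣n
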